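{- For every $\varepsilon>0$ there exist a graph $G=(V,E)$ (with at least one edge) and a partition $\Gamma$ of $V$ into nonempty groups such that, with node utilities, $\mathrm{MP}(G)-\mathrm{DF\text{ - }MP}(G,\Gamma)>1-\varepsilon$.
   Context: Max-Cut with node utilities: $\Delta(G)$ is the maximum degree, $N(v)$ the neighborhood of $v$. A cut is $S\subseteq V$; $X_{uv}(S)=1$ if exactly one of $u,v$ lies in $S$ and $0$ otherwise. Node utility: $f_S(v)=\frac{1}{\Delta(G)}\sum_{u\in N(v)}X_{uv}(S)$, $f_S(A)=\sum_{v\in A}f_S(v)$. For $\Gamma=\{V_1,\ldots,V_\gamma\}$: $\mathrm{MP}(G)=\max_{S}f_S(V)/|V|$, $\mathrm{DF\text{ - }MP}(G,\Gamma)=\max_D\min_{i\in[\gamma]}\mathbb{E}_{S\sim D}f_S(V_i)/|V_i|$, where $D$ ranges over probability distributions on subsets of $V$.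
   Formalization: The parameter ε ranges over the positive rationals, and the probability distributions D on subsets of V carry only rational weights. -}

module Defs where

open import Data.Nat as ℕ using (ℕ; zero; suc; _⊔_)
open import Data.Fin using (Fin; _≟_)
open import Data.Bool using (Bool; true; false; if_then_else_; _xor_; _∧_)
open import Data.Integer using (+_)
open import Data.Rational using (ℚ; 0ℚ; 1ℚ; _+_; _*_; _/_; _≤_)
open import Data.List using (List; foldr)
open import Data.List.Relation.Unary.All using (All)
open import Data.Product using (_×_; _,_; proj₁; proj₂; Σ; ∃)
open import Function using (_∘_)
open import Relation.Nullary.Decidable using (⌊_⌋)
open import Relation.Binary.PropositionalEquality using (_≡_)

record Graph (n : ℕ) : Set where
  field
    adj    : Fin n → Fin n → Bool
    sym    : ∀ u v → adj u v ≡ adj v u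
    irrefl : ∀ v → adj v v ≡ false
open Graph public

HasEdge : ∀ {n} → Graph n → Set
HasEdge G = ∃ λ u → ∃ λ v → adj G u v ≡ true

sumℕ : ∀ {n} → (Fin n → ℕ) → ℕ
sumℕ {zero}  f = 0
sumℕ {suc n} f = f Fin.zero ℕ.+ sumℕ (f ∘ Fin.suc)

maxℕ : ∀ {n} → (Fin n → ℕ) → ℕ
maxℕ {zero}  f = 0
maxℕ {suc n} f = f Fin.zero ⊔ maxℕ (f ∘ Fin.suc)

sumℚ : ∀ {n} → (Fin n → ℚ) → ℚ
sumℚ {zero}  f = 0ℚ
sumℚ {suc n} f = f Fin.zero + sumℚ (f ∘ Fin.suc)

-- a / b as a rational; the value for b = 0 is an irrelevant convention
-- (never used: Δ(G) ≥ 1 and all groups are nonempty in the statement)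
frac : ℕ → ℕ → ℚ
frac a zero    = 0ℚ
frac a (suc b) = (+ a) / suc b

𝟙 : Bool → ℕ
𝟙 true  = 1
𝟙 false = 0

degree : ∀ {n} → Graph n → Fin n → ℕ
degree G v = sumℕ λ u → 𝟙 (adj G v u)

Δ : ∀ {n} → Graph n → ℕ
Δ G = maxℕ (degree G)

-- a cut S ⊆ V as its characteristic function; subsets A ⊆ V likewise
Cut : ℕ → Set
Cut n = Fin n → Bool

X : ∀ {n} → Cut n → Fin n → Fin n → Bool
X S u v = S u xor S v

f : ∀ {n} → Graph n → Cut n → Fin n → ℚ
f G S v = frac (sumℕ λ u → 𝟙 (adj G v u ∧ X S u v)) (Δ G)

fSet : ∀ {n} → Graph n → Cut n → (Fin n → Bool) → ℚ
fSet G S A = sumℚ λ v → if A v then f G S v else 0ℚ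

card : ∀ {n} → (Fin n → Bool) → ℕ
card A = sumℕ λ v → 𝟙 (A v)

normalised : ∀ {n} → Graph n → Cut n → (Fin n → Bool) → ℚ
normalised G S A = fSet G S A * frac 1 (card A)

fullSet : ∀ {n} → Fin n → Bool
fullSet _ = true

-- group V_i of a partition given by a labelling g : V → Fin γ
group : ∀ {n γ} → (Fin n → Fin γ) → Fin γ → Fin n → Bool
group g i v = ⌊ g v ≟ i ⌋

Surjective : ∀ {n γ} → (Fin n → Fin γ) → Set
Surjective {n} {γ} g = ∀ (i : Fin γ) → ∃ λ v → g v ≡ i

IsMP : ∀ {n} → Graph n → ℚ → Set
IsMP G m = (∃ λ S → normalised G S fullSet ≡ m) × (∀ S → normalised G S fullSet ≤ m)

-- probability distribution on subsets of V (finite support, rational weights)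
record Dist (n : ℕ) : Set where
  field
    support  : List (ℚ × Cut n)
    nonneg   : All (λ p → 0ℚ ≤ proj₁ p) support
    total    : foldr (λ p acc → proj₁ p + acc) 0ℚ support ≡ 1ℚ
open Dist public

expect : ∀ {n} → Dist n → (Cut n → ℚ) → ℚ
expect D h = foldr (λ p acc → proj₁ p * h (proj₂ p) + acc) 0ℚ (support D)

-- the quantity min_i E_{S∼D} f_S(V_i)/|V_i| is ≤ c
MinGroupValue≤ : ∀ {n γ} → Graph n → (Fin n → Fin γ) → Dist n → ℚ → Set
MinGroupValue≤ G g D c = ∃ λ i → expect D (λ S → normalised G S (group g i)) ≤ c

{-# OPTIONS --safe #-}
-- G is an isolated vertex plus a perfect matching on N = 2m vertices, and Γ separates the
-- isolated vertex from the matched ones. Cutting every matching edge gives each matched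
-- vertex utility 1, so MP(G) = N/(N+1) = 1 - 1/(N+1), while the isolated vertex has
-- utility 0 under every cut, so every distribution leaves its group at value 0. Taking m
-- to be the denominator of ε makes 1/(N+1) < ε.
module Submission where

open import Defs
open import Data.Nat using (ℕ)
open import Data.Fin using (Fin)
open import Data.Rational using (ℚ; 0ℚ; 1ℚ; _-_; _<_)
open import Data.Product using (Σ; ∃; _×_)

open import Algebra.Properties.Group using (//-rightDivides)
open import Data.Bool using (Bool; true; false; _∧_; _xor_; if_then_else_)
open import Data.Bool.Properties using (xor-same)
open import Data.Fin using (zero; suc; _≟_)
open import Data.Fin.Properties using (suc-injective)
open import Data.Integer as ℤ using (+_; +<+; +≤+)
import Data.Integer.Properties as ℤ
open import Data.List using (List; []; _∷_; foldr)
open import Data.Nat as ℕ using (zero; suc; _⊔_; z≤n; s≤s)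
import Data.Nat.Properties as ℕ
open import Data.Nat.Coprimality using (1-coprimeTo)
open import Data.Product using (_,_; proj₁; proj₂)
open import Data.Rational as ℚ using (mkℚ; ↧ₙ_; 1/_)
import Data.Rational.Properties as ℚ
open import Data.Rational.Literals using (fromℤ)
open import Data.Rational.Unnormalised as ℚᵘ using (mkℚᵘ)
import Data.Rational.Unnormalised.Properties as ℚᵘ
open import Function using (_∘_; mk⇔)
open import Relation.Binary.PropositionalEquality as ≡
  using (_≡_; _≢_; refl; trans; cong; cong₂; subst; module ≡-Reasoning)
open import Relation.Nullary using (yes; does)
open import Relation.Nullary.Decidable using (⌊_⌋; ⌊⌋-map′; isYes≗does; does-⇔; dec-false)

sumℕ-cong : ∀ {n} {a b : Fin n → ℕ} → (∀ i → a i ≡ b i) → sumℕ a ≡ sumℕ b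
sumℕ-cong {zero}  a≗b = refl
sumℕ-cong {suc n} a≗b = cong₂ ℕ._+_ (a≗b zero) (sumℕ-cong (a≗b ∘ suc))

sumℕ-mono-≤ : ∀ {n} {a b : Fin n → ℕ} → (∀ i → a i ℕ.≤ b i) → sumℕ a ℕ.≤ sumℕ b
sumℕ-mono-≤ {zero}  a≤b = z≤n
sumℕ-mono-≤ {suc n} a≤b = ℕ.+-mono-≤ (a≤b zero) (sumℕ-mono-≤ (a≤b ∘ suc))

sumℕ-const : ∀ n k → sumℕ {n} (λ _ → k) ≡ n ℕ.* k
sumℕ-const zero    k = refl
sumℕ-const (suc n) k = cong (k ℕ.+_) (sumℕ-const n k)

sumℕ-𝟙-≟ : ∀ {n} (a : Fin n) → sumℕ (λ u → 𝟙 ⌊ u ≟ a ⌋) ≡ 1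
sumℕ-𝟙-≟ {suc n} zero    = cong suc (trans (sumℕ-const n 0) (ℕ.*-zeroʳ n))
sumℕ-𝟙-≟ {suc n} (suc a) =
  trans (sumℕ-cong λ u → cong 𝟙 (⌊⌋-map′ (cong suc) suc-injective (u ≟ a))) (sumℕ-𝟙-≟ a)

maxℕ-const : ∀ {n} k (h : Fin (suc n) → ℕ) → (∀ i → h i ≡ k) → maxℕ h ≡ k
maxℕ-const {zero}  k h h≡k = trans (cong (_⊔ 0) (h≡k zero)) (ℕ.⊔-identityʳ k)
maxℕ-const {suc n} k h h≡k =
  trans (cong₂ _⊔_ (h≡k zero) (maxℕ-const k (h ∘ suc) (h≡k ∘ suc))) (ℕ.⊔-idem k)

sumℚ-cong : ∀ {n} {a b : Fin n → ℚ} → (∀ i → a i ≡ b i) → sumℚ a ≡ sumℚ b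
sumℚ-cong {zero}  a≗b = refl
sumℚ-cong {suc n} a≗b = cong₂ ℚ._+_ (a≗b zero) (sumℚ-cong (a≗b ∘ suc))

sumℚ-mono-≤ : ∀ {n} {a b : Fin n → ℚ} → (∀ i → a i ℚ.≤ b i) → sumℚ a ℚ.≤ sumℚ b
sumℚ-mono-≤ {zero}  a≤b = ℚ.≤-refl
sumℚ-mono-≤ {suc n} a≤b = ℚ.+-mono-≤ (a≤b zero) (sumℚ-mono-≤ (a≤b ∘ suc))

sumℚ-zero : ∀ n → sumℚ {n} (λ _ → 0ℚ) ≡ 0ℚ
sumℚ-zero zero    = refl
sumℚ-zero (suc n) = cong (0ℚ ℚ.+_) (sumℚ-zero n)

-- The left-hand side computes to (+ 1 ℤ.+ + n ℤ.* + 1) ℚ./ 1.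
1ℚ+fromℤ≡fromℤ-suc : ∀ n → 1ℚ ℚ.+ fromℤ (+ n) ≡ fromℤ (+ suc n)
1ℚ+fromℤ≡fromℤ-suc n = trans (cong (λ z → (+ 1 ℤ.+ z) ℚ./ 1) (ℤ.*-identityʳ (+ n))) (ℚ.↥p/↧p≡p (fromℤ (+ suc n)))

sumℚ-one : ∀ n → sumℚ {n} (λ _ → 1ℚ) ≡ fromℤ (+ n)
sumℚ-one zero    = refl
sumℚ-one (suc n) = trans (cong (1ℚ ℚ.+_) (sumℚ-one n)) (1ℚ+fromℤ≡fromℤ-suc n)

frac-zero : ∀ d → frac 0 d ≡ 0ℚ
frac-zero zero    = refl
frac-zero (suc d) = ℚ.0/n≡0 (suc d)

frac-nonNeg : ∀ a d → ℚ.NonNegative (frac a d)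
frac-nonNeg a zero    = _
frac-nonNeg a (suc d) = ℚ.normalize-nonNeg a (suc d)

frac-monoˡ-≤ : ∀ {a b} d → a ℕ.≤ b → frac a d ℚ.≤ frac b d
frac-monoˡ-≤ zero _ = ℚ.≤-refl
frac-monoˡ-≤ {a} {b} (suc d) a≤b = ℚ.toℚᵘ-cancel-≤
  (ℚᵘ.≤-respˡ-≃ (ℚᵘ.≃-sym (ℚ.toℚᵘ-fromℚᵘ (mkℚᵘ (+ a) d)))
  (ℚᵘ.≤-respʳ-≃ (ℚᵘ.≃-sym (ℚ.toℚᵘ-fromℚᵘ (mkℚᵘ (+ b) d)))
  (ℚᵘ.*≤* (ℤ.*-monoʳ-≤-nonNeg (+ suc d) (+≤+ a≤b)))))

sumℚ-one-*-frac-self≡1 : ∀ n → sumℚ {suc n} (λ _ → 1ℚ) ℚ.* frac 1 (suc n) ≡ 1ℚ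
sumℚ-one-*-frac-self≡1 n = trans
  (cong₂ ℚ._*_ (sumℚ-one (suc n)) (ℚ.↥p/↧p≡p (1/ fromℤ (+ suc n))))
  (ℚ.*-inverseʳ (fromℤ (+ suc n)))

sumℚ-one-*-frac-suc≡1-frac : ∀ n → sumℚ {n} (λ _ → 1ℚ) ℚ.* frac 1 (suc n) ≡ 1ℚ - frac 1 (suc n)
sumℚ-one-*-frac-suc≡1-frac n = begin
  s ℚ.* r               ≡⟨ ≡.sym (proj₂ (//-rightDivides ℚ.+-0-group) r (s ℚ.* r)) ⟩
  (s ℚ.* r ℚ.+ r) - r   ≡⟨ cong (_- r) sum≡1 ⟩
  1ℚ - r                ∎
  where
  open ≡-Reasoning
  s r : ℚ
  s = sumℚ {n} (λ _ → 1ℚ)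
  r = frac 1 (suc n)
  sum≡1 : s ℚ.* r ℚ.+ r ≡ 1ℚ
  sum≡1 = begin
    s ℚ.* r ℚ.+ r           ≡⟨ ℚ.+-comm (s ℚ.* r) r ⟩
    r ℚ.+ s ℚ.* r           ≡⟨ cong (ℚ._+ s ℚ.* r) (≡.sym (ℚ.*-identityˡ r)) ⟩
    1ℚ ℚ.* r ℚ.+ s ℚ.* r    ≡⟨ ≡.sym (ℚ.*-distribʳ-+ r 1ℚ s) ⟩
    (1ℚ ℚ.+ s) ℚ.* r        ≡⟨ sumℚ-one-*-frac-self≡1 n ⟩
    1ℚ                      ∎

frac-1-suc<pos : ∀ ε → 0ℚ < ε → ∀ {n} → ↧ₙ ε ℕ.≤ n → frac 1 (suc n) < ε
frac-1-suc<pos (mkℚ (+ zero)    _ _) (ℚ.*<* (+<+ ()))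
frac-1-suc<pos (mkℚ ℤ.-[1+ _ ] _ _) (ℚ.*<* ())
frac-1-suc<pos ε@(mkℚ (+ suc a) d _) _ {n} ↧ε≤n =
  subst (_< ε) (≡.sym (ℚ.↥p/↧p≡p (mkℚ (+ 1) n (1-coprimeTo (suc n)))))
    (ℚ.*<* (+<+ (begin-strict
      1 ℕ.* suc d      ≡⟨ ℕ.*-identityˡ (suc d) ⟩
      suc d            ≤⟨ ↧ε≤n ⟩
      n                <⟨ ℕ.n<1+n n ⟩
      suc n            ≤⟨ ℕ.m≤n*m (suc n) (suc a) ⟩
      suc a ℕ.* suc n  ∎)))
  where open ℕ.≤-Reasoning

expect-zero : ∀ {n} (D : Dist n) {h : Cut n → ℚ} → (∀ S → h S ≡ 0ℚ) → expect D h ≡ 0ℚ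
expect-zero {n} D {h} h≡0 = go (support D)
  where
  go : (L : List (ℚ × Cut n)) → foldr (λ p acc → proj₁ p ℚ.* h (proj₂ p) ℚ.+ acc) 0ℚ L ≡ 0ℚ
  go []            = refl
  go ((w , S) ∷ L) = cong₂ ℚ._+_ (trans (cong (w ℚ.*_) (h≡0 S)) (ℚ.*-zeroʳ w)) (go L)

module _ {n} (G : Graph n) where

  cutDegree : Cut n → Fin n → ℕ
  cutDegree S v = sumℕ λ u → 𝟙 (adj G v u ∧ X S u v)

  CutsEveryEdge : Cut n → Set
  CutsEveryEdge S = ∀ u v → adj G u v ≡ true → X S u v ≡ true

  cutDegree≤degree : ∀ S v → cutDegree S v ℕ.≤ degree G v
  cutDegree≤degree S v = sumℕ-mono-≤ λ u → 𝟙-∧-≤ (adj G v u) (X S u v)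
    where
    𝟙-∧-≤ : ∀ b c → 𝟙 (b ∧ c) ℕ.≤ 𝟙 b
    𝟙-∧-≤ false _     = z≤n
    𝟙-∧-≤ true  false = z≤n
    𝟙-∧-≤ true  true  = ℕ.≤-refl

  cutDegree≡degree : ∀ {T} → CutsEveryEdge T → ∀ v → cutDegree T v ≡ degree G v
  cutDegree≡degree {T} cuts v = sumℕ-cong λ u → cong 𝟙 (edge-cut u)
    where
    edge-cut : ∀ u → (adj G v u ∧ X T u v) ≡ adj G v u
    edge-cut u with adj G v u in vu
    ... | true  = cuts u v (trans (Graph.sym G u v) vu)
    ... | false = refl

  f≤f-cutsEveryEdge : ∀ {T} → CutsEveryEdge T → ∀ S v → f G S v ℚ.≤ f G T v
  f≤f-cutsEveryEdge {T} cuts S v = frac-monoˡ-≤ (Δ G)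
    (ℕ.≤-trans (cutDegree≤degree S v) (ℕ.≤-reflexive (≡.sym (cutDegree≡degree {T} cuts v))))

  normalised-mono-≤ : ∀ {S T} → (∀ v → f G S v ℚ.≤ f G T v) → ∀ A → normalised G S A ℚ.≤ normalised G T A
  normalised-mono-≤ {S} {T} S≤T A =
    ℚ.*-monoʳ-≤-nonNeg (frac 1 (card A)) {{frac-nonNeg 1 (card A)}} (sumℚ-mono-≤ term-mono)
    where
    term-mono : ∀ v → (if A v then f G S v else 0ℚ) ℚ.≤ (if A v then f G T v else 0ℚ)
    term-mono v with A v
    ... | true  = S≤T v
    ... | false = ℚ.≤-refl

  cutsEveryEdge⇒IsMP : ∀ {T} → CutsEveryEdge T → IsMP G (normalised G T fullSet)
  cutsEveryEdge⇒IsMP {T} cuts = (T , refl) , λ S → normalised-mono-≤ {S} {T} (f≤f-cutsEveryEdge {T} cuts S) fullSet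

  f-isolated : ∀ S {v} → degree G v ≡ 0 → f G S v ≡ 0ℚ
  f-isolated S {v} deg≡0 = trans
    (cong (λ k → frac k (Δ G)) (ℕ.n≤0⇒n≡0 (ℕ.≤-trans (cutDegree≤degree S v) (ℕ.≤-reflexive deg≡0))))
    (frac-zero (Δ G))

  normalised-isolated : ∀ S A → (∀ v → A v ≡ true → degree G v ≡ 0) → normalised G S A ≡ 0ℚ
  normalised-isolated S A isolated = begin
    fSet G S A ℚ.* frac 1 (card A) ≡⟨ cong (ℚ._* frac 1 (card A)) (trans (sumℚ-cong term≡0) (sumℚ-zero n)) ⟩
    0ℚ ℚ.* frac 1 (card A)         ≡⟨ ℚ.*-zeroˡ (frac 1 (card A)) ⟩
    0ℚ                             ∎
    where
    open ≡-Reasoning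
    term≡0 : ∀ v → (if A v then f G S v else 0ℚ) ≡ 0ℚ
    term≡0 v with A v in e
    ... | true  = f-isolated S (isolated v e)
    ... | false = refl

  isolatedGroup⇒MinGroupValue≤0 : ∀ {γ} (g : Fin n → Fin γ) i →
    (∀ v → group g i v ≡ true → degree G v ≡ 0) → ∀ D → MinGroupValue≤ G g D 0ℚ
  isolatedGroup⇒MinGroupValue≤0 g i isolated D =
    i , ℚ.≤-reflexive (expect-zero D λ S → normalised-isolated S (group g i) isolated)

twice : ℕ → ℕ
twice zero    = zero
twice (suc m) = suc (suc (twice m))

n≤twice : ∀ n → n ℕ.≤ twice n
n≤twice zero    = z≤n
n≤twice (suc n) = ℕ.m≤n⇒m≤1+n (s≤s (n≤twice n))

partner : ∀ {m} → Fin (twice m) → Fin (twice m)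
partner {suc m} zero          = suc zero
partner {suc m} (suc zero)    = zero
partner {suc m} (suc (suc i)) = suc (suc (partner i))

partner-involutive : ∀ {m} (i : Fin (twice m)) → partner (partner i) ≡ i
partner-involutive {suc m} zero          = refl
partner-involutive {suc m} (suc zero)    = refl
partner-involutive {suc m} (suc (suc i)) = cong (λ j → suc (suc j)) (partner-involutive i)

partner-swap : ∀ {m} {u v : Fin (twice m)} → v ≡ partner u → u ≡ partner v
partner-swap {u = u} v≡pu = trans (≡.sym (partner-involutive u)) (cong partner (≡.sym v≡pu))

isEven : ∀ {m} → Fin (twice m) → Bool
isEven {suc m} zero          = true
isEven {suc m} (suc zero)    = false
isEven {suc m} (suc (suc i)) = isEven i

isEven-xor-partner : ∀ {m} (i : Fin (twice m)) → (isEven i xor isEven (partner i)) ≡ true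
isEven-xor-partner {suc m} zero          = refl
isEven-xor-partner {suc m} (suc zero)    = refl
isEven-xor-partner {suc m} (suc (suc i)) = isEven-xor-partner i

partner-noFixpoint : ∀ {m} (i : Fin (twice m)) → i ≢ partner i
partner-noFixpoint i i≡pi with () ← trans (≡.sym (xor-same (isEven i)))
  (trans (cong (λ j → isEven i xor isEven j) i≡pi) (isEven-xor-partner i))

matchingAdj : ∀ {m} → Fin (suc (twice m)) → Fin (suc (twice m)) → Bool
matchingAdj zero    _       = false
matchingAdj (suc u) zero    = false
matchingAdj (suc u) (suc v) = ⌊ v ≟ partner u ⌋

matchingAdj-sym : ∀ {m} (u v : Fin (suc (twice m))) → matchingAdj u v ≡ matchingAdj v u
matchingAdj-sym zero    zero    = refl
matchingAdj-sym zero    (suc v) = refl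
matchingAdj-sym (suc u) zero    = refl
matchingAdj-sym (suc u) (suc v) = begin
  ⌊ v ≟ partner u ⌋     ≡⟨ isYes≗does (v ≟ partner u) ⟩
  does (v ≟ partner u)  ≡⟨ does-⇔ (mk⇔ partner-swap partner-swap) (v ≟ partner u) (u ≟ partner v) ⟩
  does (u ≟ partner v)  ≡⟨ isYes≗does (u ≟ partner v) ⟨
  ⌊ u ≟ partner v ⌋     ∎
  where open ≡-Reasoning

matchingAdj-irrefl : ∀ {m} (v : Fin (suc (twice m))) → matchingAdj v v ≡ false
matchingAdj-irrefl zero    = refl
matchingAdj-irrefl (suc v) = trans (isYes≗does (v ≟ partner v)) (dec-false (v ≟ partner v) (partner-noFixpoint v))

matchingWithIsolatedVertex : ∀ m → Graph (suc (twice m))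
matchingWithIsolatedVertex m = record { adj = matchingAdj ; sym = matchingAdj-sym ; irrefl = matchingAdj-irrefl }

module MatchingWithIsolatedVertex (m : ℕ) where

  N : ℕ
  N = twice (suc m)

  G : Graph (suc N)
  G = matchingWithIsolatedVertex (suc m)

  hasEdge : HasEdge G
  hasEdge = suc zero , suc (suc zero) , refl

  degree-isolated : degree G zero ≡ 0
  degree-isolated = trans (sumℕ-const N 0) (ℕ.*-zeroʳ N)

  degree-matched : ∀ v → degree G (suc v) ≡ 1
  degree-matched v = sumℕ-𝟙-≟ (partner v)

  Δ≡1 : Δ G ≡ 1
  Δ≡1 = cong₂ _⊔_ degree-isolated (maxℕ-const 1 (degree G ∘ suc) degree-matched)

  evenCut : Cut (suc N)
  evenCut zero    = false
  evenCut (suc v) = isEven v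

  evenCut-cutsEveryEdge : CutsEveryEdge G evenCut
  evenCut-cutsEveryEdge zero    _       ()
  evenCut-cutsEveryEdge (suc u) zero    ()
  evenCut-cutsEveryEdge (suc u) (suc v) uv with v ≟ partner u
  ... | yes refl = isEven-xor-partner u

  evenCut-matched : ∀ v → f G evenCut (suc v) ≡ 1ℚ
  evenCut-matched v = cong₂ frac
    (trans (cutDegree≡degree G {evenCut} evenCut-cutsEveryEdge (suc v)) (degree-matched v)) Δ≡1

  evenCut-value : normalised G evenCut fullSet ≡ 1ℚ - frac 1 (suc N)
  evenCut-value = begin
    fSet G evenCut fullSet ℚ.* frac 1 (card {suc N} fullSet)
      ≡⟨ cong₂ ℚ._*_ fSet≡ (cong (frac 1) (trans (sumℕ-const (suc N) 1) (ℕ.*-identityʳ (suc N)))) ⟩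
    (0ℚ ℚ.+ sumℚ {N} (λ _ → 1ℚ)) ℚ.* frac 1 (suc N)
      ≡⟨ cong (ℚ._* frac 1 (suc N)) (ℚ.+-identityˡ (sumℚ {N} (λ _ → 1ℚ))) ⟩
    sumℚ {N} (λ _ → 1ℚ) ℚ.* frac 1 (suc N)
      ≡⟨ sumℚ-one-*-frac-suc≡1-frac N ⟩
    1ℚ - frac 1 (suc N) ∎
    where
    open ≡-Reasoning
    fSet≡ : fSet G evenCut fullSet ≡ 0ℚ ℚ.+ sumℚ {N} (λ _ → 1ℚ)
    fSet≡ = cong₂ ℚ._+_ (f-isolated G evenCut {zero} degree-isolated) (sumℚ-cong evenCut-matched)

  isolatedOrMatched : Fin (suc N) → Fin 2
  isolatedOrMatched zero    = zero
  isolatedOrMatched (suc _) = suc zero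

  isolatedOrMatched-surjective : Surjective isolatedOrMatched
  isolatedOrMatched-surjective zero       = zero , refl
  isolatedOrMatched-surjective (suc zero) = suc zero , refl

  isolatedGroup : ∀ v → group isolatedOrMatched zero v ≡ true → degree G v ≡ 0
  isolatedGroup zero    _  = degree-isolated
  isolatedGroup (suc v) ()

proposition4p14 :
    (ε : ℚ) → 0ℚ < ε →
    ∃ λ (n : ℕ) → Σ (Graph n) λ G → HasEdge G ×
      (∃ λ (γ : ℕ) → Σ (Fin n → Fin γ) λ g → Surjective g ×
        (∃ λ (mp : ℚ) → IsMP G mp ×
          (∃ λ (c : ℚ) →
            (∀ (D : Dist n) → MinGroupValue≤ G g D c) ×
            (1ℚ - ε < mp - c))))
proposition4p14 ε ε>0 =
  suc N , G , hasEdge ,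
  2 , isolatedOrMatched , isolatedOrMatched-surjective ,
  mp , cutsEveryEdge⇒IsMP G {evenCut} evenCut-cutsEveryEdge ,
  0ℚ , isolatedGroup⇒MinGroupValue≤0 G isolatedOrMatched zero isolatedGroup , gap
  where
  open MatchingWithIsolatedVertex (ℚ.denominator-1 ε)
  mp : ℚ
  mp = normalised G evenCut fullSet
  gap : 1ℚ - ε < mp - 0ℚ
  gap = subst (1ℚ - ε <_) (≡.sym (trans (ℚ.+-identityʳ mp) evenCut-value))
    (ℚ.+-monoʳ-< 1ℚ (ℚ.neg-antimono-< (frac-1-suc<pos ε ε>0 (n≤twice (↧ₙ ε)))))
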